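{- If $G$ is a connected $P_3$-free graph with $n$ vertices, then $ch_B(G) = \chi_B(G) = \chi_S(G) = ch_S(G) = n$.
   Context: All graphs are finite and simple; $P_3$ is the path on three vertices, and $P_3$-free means no induced $P_3$. A biclique of $G$ is a set $W\subseteq V(G)$ with $G[W]$ complete bipartite $K_{n,m}$ ($n,m\ge1$); a star is a biclique inducing $K_{1,m}$; maximal means not properly contained in another biclique (resp. star). A coloring is a map $\rho:V(G)\to\mathbb N$, a $k$-coloring has values in $\{1,\dots,k\}$; a set $W$ is monochromatic if $|\rho(W)|=1$. A star (biclique) coloring has no monochromatic maximal star (biclique). For a list assignment $L$ ($L(v)\subseteq \mathbb N$, a $k$-list assignment if $|L(v)|=k$), an $L$-coloring satisfies $\rho(v)\in L(v)$; $G$ is star (biclique) $k$-choosable if for every $k$-list assignment $L$ there is an $L$-coloring with no monochromatic maximal star (biclique). $\chi_S(G)$, $\chi_B(G)$ are the minimum $k$ such that $G$ admits a star, resp. biclique, $k$-coloring; $ch_S(G)$, $ch_B(G)$ are the minimum $k$ such that $G$ is star, resp. biclique, $k$-choosable. -}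

module Defs where

open import Data.Nat using (ℕ; suc; _≤_; _<_)
open import Data.Fin using (Fin)
open import Data.Bool using (Bool; true; false)
open import Data.List using (List; length)
open import Data.List.Membership.Propositional renaming (_∈_ to _∈ˡ_)
open import Data.List.Relation.Unary.Unique.Propositional using (Unique)
open import Data.Product using (Σ; ∃; ∃-syntax; _×_; _,_)
open import Relation.Nullary using (¬_)
open import Relation.Binary.PropositionalEquality using (_≡_; _≢_)

record Graph (n : ℕ) : Set where
  field
    adj   : Fin n → Fin n → Bool
    sym   : ∀ u v → adj u v ≡ adj v u
    irrefl : ∀ v → adj v v ≡ false

module _ {n : ℕ} (G : Graph n) where
  open Graph G

  VSet : Set
  VSet = Fin n → Bool

  _∈_ : Fin n → VSet → Set
  v ∈ W = W v ≡ true

  _⊆_ : VSet → VSet → Set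
  W ⊆ W' = ∀ v → v ∈ W → v ∈ W'

  Adj : Fin n → Fin n → Set
  Adj u v = adj u v ≡ true

  data Reach : Fin n → Fin n → Set where
    here : ∀ {u} → Reach u u
    step : ∀ {u v w} → Adj u v → Reach v w → Reach u w

  Connected : Set
  Connected = ∀ u v → Reach u v

  -- no induced P3: a-b-c path with a ≠ c and a,c non-adjacent
  P3Free : Set
  P3Free = ∀ a b c → Adj a b → Adj b c → a ≢ c → Adj a c

  -- G[W] is complete bipartite K_{p,q} with parts {side = true}, {side = false}
  IsBipartitionOf : VSet → (Fin n → Bool) → Set
  IsBipartitionOf W side =
    (∃[ u ] (u ∈ W × side u ≡ true)) ×
    (∃[ v ] (v ∈ W × side v ≡ false)) ×
    (∀ u v → u ∈ W → v ∈ W → (Adj u v → side u ≢ side v) × (side u ≢ side v → Adj u v))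

  Biclique : VSet → Set
  Biclique W = ∃[ side ] IsBipartitionOf W side

  Star : VSet → Set
  Star W = ∃[ side ] (IsBipartitionOf W side ×
             ∃[ c ] (∀ u → u ∈ W → side u ≡ true → u ≡ c))

  MaximalBiclique : VSet → Set
  MaximalBiclique W = Biclique W × (∀ W' → Biclique W' → W ⊆ W' → W' ⊆ W)

  MaximalStar : VSet → Set
  MaximalStar W = Star W × (∀ W' → Star W' → W ⊆ W' → W' ⊆ W)

  Coloring : Set
  Coloring = Fin n → ℕ

  IsKColoring : ℕ → Coloring → Set
  IsKColoring k ρ = ∀ v → 1 ≤ ρ v × ρ v ≤ k

  Monochromatic : Coloring → VSet → Set
  Monochromatic ρ W = (∃[ u ] u ∈ W) × (∀ u v → u ∈ W → v ∈ W → ρ u ≡ ρ v)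

  IsStarColoring : Coloring → Set
  IsStarColoring ρ = ∀ W → MaximalStar W → ¬ Monochromatic ρ W

  IsBicliqueColoring : Coloring → Set
  IsBicliqueColoring ρ = ∀ W → MaximalBiclique W → ¬ Monochromatic ρ W

  IsKListAssignment : ℕ → (Fin n → List ℕ) → Set
  IsKListAssignment k L = ∀ v → Unique (L v) × length (L v) ≡ k

  IsLColoring : (Fin n → List ℕ) → Coloring → Set
  IsLColoring L ρ = ∀ v → ρ v ∈ˡ L v

  StarKColorable : ℕ → Set
  StarKColorable k = ∃[ ρ ] (IsKColoring k ρ × IsStarColoring ρ)

  BicliqueKColorable : ℕ → Set
  BicliqueKColorable k = ∃[ ρ ] (IsKColoring k ρ × IsBicliqueColoring ρ)

  StarKChoosable : ℕ → Set
  StarKChoosable k = ∀ L → IsKListAssignment k L → ∃[ ρ ] (IsLColoring L ρ × IsStarColoring ρ)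

  BicliqueKChoosable : ℕ → Set
  BicliqueKChoosable k = ∀ L → IsKListAssignment k L → ∃[ ρ ] (IsLColoring L ρ × IsBicliqueColoring ρ)

IsMin : (ℕ → Set) → ℕ → Set
IsMin P m = P m × (∀ k → k < m → ¬ P k)

χS χB chS chB : ∀ {n} → Graph n → ℕ → Set
χS G m = IsMin (StarKColorable G) m
χB G m = IsMin (BicliqueKColorable G) m
chS G m = IsMin (StarKChoosable G) m
chB G m = IsMin (BicliqueKChoosable G) m

module Submission where

-- A walk in a P₃-free graph shortcuts to an edge, so a connected P₃-free graph is complete.
-- In a complete graph any two vertices form a maximal star and a maximal biclique (a third
-- vertex would close a triangle, impossible in a bipartite set), so a star or biclique
-- colouring is exactly an injective colouring. Hence at least n colours are needed, and
-- n suffice even from lists: choose pairwise distinct colours from the n-element lists greedily.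

open import Defs hiding (_∈_; _⊆_)
import Defs
open import Data.Bool using (true; false; _∨_)
open import Data.Bool.Properties using (¬-not)
open import Data.Empty using (⊥; ⊥-elim)
open import Data.Fin using (Fin; zero; suc; _≟_)
open import Data.Fin.Properties using (injective⇒≤)
open import Data.List using (List; length; lookup; tabulate; applyUpTo)
open import Data.List.Properties using (length-tabulate; length-applyUpTo)
open import Data.List.Membership.Propositional using (_∉_; find) renaming (_∈_ to _∈ˡ_)
open import Data.List.Membership.Propositional.Properties
  using (∈-lookup; ∈-tabulate⁺; ∈-tabulate⁻; ∈-applyUpTo⁺; ∈-applyUpTo⁻)
open import Data.List.Membership.Setoid.Properties using (index-injective)
open import Data.List.Relation.Binary.Subset.Propositional renaming (_⊆_ to _⊆ˡ_)
open import Data.List.Relation.Unary.All as All using (all?)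
open import Data.List.Relation.Unary.All.Properties using (¬All⇒Any¬)
open import Data.List.Relation.Unary.AllPairs using (_∷_)
open import Data.List.Relation.Unary.Any using (index)
open import Data.List.Relation.Unary.Unique.Propositional using (Unique)
open import Data.List.Relation.Unary.Unique.Propositional.Properties using (tabulate⁺; applyUpTo⁺₁)
import Data.Nat as ℕ
open import Data.Nat using (ℕ; suc; _≤_; _<_; s≤s; z≤n)
open import Data.Nat.Properties using (≤-trans; ≤-reflexive; n≤1+n; <⇒≱; <⇒≢; suc-injective; module ≤-Reasoning)
open import Data.Product using (_×_; _,_; proj₁; proj₂; ∃-syntax; map₂)
open import Data.Sum using (_⊎_; inj₁; inj₂)
open import Function using (_∘_)
open import Function.Definitions using (Injective)
open import Relation.Binary.Definitions using (DecidableEquality)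
open import Relation.Binary.PropositionalEquality using (_≡_; _≢_; refl; sym; trans; cong; subst; setoid)
open import Relation.Nullary using (¬_; yes; no; does; contradiction)
open import Relation.Nullary.Decidable using (dec-true; dec-false)

lookup-injective : ∀ {A : Set} {xs : List A} → Unique xs → Injective _≡_ _≡_ (lookup xs)
lookup-injective (_ ∷ _) {zero} {zero} _ = refl
lookup-injective (x∉xs ∷ _) {zero} {suc j} eq = contradiction eq (All.lookup x∉xs (∈-lookup j))
lookup-injective (x∉xs ∷ _) {suc i} {zero} eq = contradiction (sym eq) (All.lookup x∉xs (∈-lookup i))
lookup-injective (_ ∷ xs-unique) {suc i} {suc j} eq = cong suc (lookup-injective xs-unique eq)

Unique∧⊆⇒length≤ : ∀ {A : Set} {xs ys : List A} → Unique xs → xs ⊆ˡ ys → length xs ≤ length ys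
Unique∧⊆⇒length≤ {A} {xs} {ys} xs-unique xs⊆ys = injective⇒≤ position-injective
  where
  position : Fin (length xs) → Fin (length ys)
  position i = index (xs⊆ys (∈-lookup i))

  position-injective : Injective _≡_ _≡_ position
  position-injective {i} {j} =
    lookup-injective xs-unique ∘ index-injective (setoid A) (xs⊆ys (∈-lookup i)) (xs⊆ys (∈-lookup j))

injective⇒≤length : ∀ {A : Set} {n} {xs : List A} (f : Fin n → A) →
                    (∀ i → f i ∈ˡ xs) → Injective _≡_ _≡_ f → n ≤ length xs
injective⇒≤length {n = n} {xs} f f∈xs f-injective = begin
  n                   ≡⟨ length-tabulate f ⟨
  length (tabulate f) ≤⟨ Unique∧⊆⇒length≤ (tabulate⁺ f-injective) image⊆xs ⟩
  length xs           ∎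
  where
  open ≤-Reasoning
  image⊆xs : tabulate f ⊆ˡ xs
  image⊆xs x∈image with ∈-tabulate⁻ x∈image
  ... | i , refl = f∈xs i

module _ {A : Set} (_≟ᴬ_ : DecidableEquality A) where
  open import Data.List.Membership.DecPropositional _≟ᴬ_ using (_∈?_)

  ∃-∉ : ∀ {xs ys : List A} → Unique xs → length ys < length xs → ∃[ x ] (x ∈ˡ xs × x ∉ ys)
  ∃-∉ {xs} {ys} xs-unique ys<xs with all? (_∈? ys) xs
  ... | no ¬xs⊆ys = find (¬All⇒Any¬ (_∈? ys) xs ¬xs⊆ys)
  ... | yes xs⊆ys = contradiction (Unique∧⊆⇒length≤ xs-unique (All.lookup xs⊆ys)) (<⇒≱ ys<xs)

  -- After representing the last m lists, the first one (of size ≥ m + 1) still has an unused element.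
  distinct-representatives : ∀ m (L : Fin m → List A) → (∀ i → Unique (L i) × m ≤ length (L i)) →
                             ∃[ ρ ] ((∀ i → ρ i ∈ˡ L i) × Injective _≡_ _≡_ ρ)
  distinct-representatives 0 L _ = (λ ()) , (λ ()) , λ { {()} }
  distinct-representatives (suc m) L L-large
    with distinct-representatives m (L ∘ suc) (map₂ (≤-trans (n≤1+n m)) ∘ L-large ∘ suc)
  ... | ρ′ , ρ′∈L , ρ′-injective
    with ∃-∉ {ys = tabulate ρ′} (proj₁ (L-large zero))
             (≤-trans (s≤s (≤-reflexive (length-tabulate ρ′))) (proj₂ (L-large zero)))
  ... | c , c∈L₀ , c∉ρ′ = ρ , ρ∈L , ρ-injective
    where
    ρ : Fin (suc m) → A
    ρ zero    = c
    ρ (suc i) = ρ′ i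

    ρ∈L : ∀ i → ρ i ∈ˡ L i
    ρ∈L zero    = c∈L₀
    ρ∈L (suc i) = ρ′∈L i

    ρ-injective : Injective _≡_ _≡_ ρ
    ρ-injective {zero}  {zero}  _  = refl
    ρ-injective {zero}  {suc j} eq = ⊥-elim (c∉ρ′ (subst (_∈ˡ tabulate ρ′) (sym eq) (∈-tabulate⁺ j)))
    ρ-injective {suc i} {zero}  eq = ⊥-elim (c∉ρ′ (subst (_∈ˡ tabulate ρ′) eq (∈-tabulate⁺ i)))
    ρ-injective {suc i} {suc j} eq = cong suc (ρ′-injective eq)

palette : ℕ → List ℕ
palette k = applyUpTo suc k

palette-unique : ∀ k → Unique (palette k)
palette-unique k = applyUpTo⁺₁ suc k (λ i<j _ → <⇒≢ i<j ∘ suc-injective)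

∈-palette⁺ : ∀ {k x} → 1 ≤ x → x ≤ k → x ∈ˡ palette k
∈-palette⁺ (s≤s z≤n) x≤k = ∈-applyUpTo⁺ suc x≤k

∈-palette⁻ : ∀ {k x} → x ∈ˡ palette k → 1 ≤ x × x ≤ k
∈-palette⁻ x∈palette with ∈-applyUpTo⁻ suc x∈palette
... | _ , i<k , refl = s≤s z≤n , i<k

module _ {n : ℕ} (G : Graph n) where
  open Graph G using (irrefl) renaming (sym to adj-sym)

  infix 4 _∈_ _⊆_

  _∈_ : Fin n → VSet G → Set
  _∈_ = Defs._∈_ G

  _⊆_ : VSet G → VSet G → Set
  _⊆_ = Defs._⊆_ G

  Complete : Set
  Complete = ∀ u v → u ≢ v → Adj G u v

  connected∧P3Free⇒complete : Connected G → P3Free G → Complete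
  connected∧P3Free⇒complete connected p3-free u v = adjacent-along (connected u v)
    where
    adjacent-along : ∀ {a b} → Reach G a b → a ≢ b → Adj G a b
    adjacent-along here a≢a = contradiction refl a≢a
    adjacent-along (step {v = w} {w = b} a~w w⇝b) a≢b with w ≟ b
    ... | yes refl = a~w
    ... | no w≢b   = p3-free _ w b a~w (adjacent-along w⇝b w≢b) a≢b

  adj⇒≢ : ∀ {u v} → Adj G u v → u ≢ v
  adj⇒≢ {u} u~u refl = contradiction (trans (sym u~u) (irrefl u)) λ ()

  bipartition-triangle-free : ∀ {W side a b c} → IsBipartitionOf G W side →
                              a ∈ W → b ∈ W → c ∈ W → Adj G a b → Adj G b c → Adj G a c → ⊥
  bipartition-triangle-free {side = side} {a} {b} {c} (_ , _ , edges) a∈W b∈W c∈W a~b b~c a~c =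
    proj₁ (edges a c a∈W c∈W) a~c (trans (¬-not a≢b) (sym (¬-not c≢b)))
    where
    a≢b : side a ≢ side b
    a≢b = proj₁ (edges a b a∈W b∈W) a~b
    c≢b : side c ≢ side b
    c≢b = proj₁ (edges b c b∈W c∈W) b~c ∘ sym

  pair : Fin n → Fin n → VSet G
  pair u v x = does (x ≟ u) ∨ does (x ≟ v)

  ∈-pair⁻ : ∀ u v x → x ∈ pair u v → x ≡ u ⊎ x ≡ v
  ∈-pair⁻ u v x x∈pair with x ≟ u | x ≟ v
  ... | yes x≡u | _       = inj₁ x≡u
  ... | no _    | yes x≡v = inj₂ x≡v
  ... | no _    | no _    = contradiction x∈pair λ ()

  ∈-pairˡ : ∀ u v → u ∈ pair u v
  ∈-pairˡ u _ with u ≟ u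
  ... | yes _   = refl
  ... | no u≢u  = contradiction refl u≢u

  ∈-pairʳ : ∀ u v → v ∈ pair u v
  ∈-pairʳ u v with v ≟ u | v ≟ v
  ... | yes _ | _       = refl
  ... | no _  | yes _   = refl
  ... | no _  | no v≢v  = contradiction refl v≢v

  edge-bipartition : ∀ {u v} → Adj G u v → IsBipartitionOf G (pair u v) (λ x → does (x ≟ u))
  edge-bipartition {u} {v} u~v = (u , ∈-pairˡ u v , side-u) , (v , ∈-pairʳ u v , side-v) , edges
    where
    side-u : does (u ≟ u) ≡ true
    side-u = dec-true (u ≟ u) refl
    side-v : does (v ≟ u) ≡ false
    side-v = dec-false (v ≟ u) (adj⇒≢ u~v ∘ sym)
    sides-differ : does (u ≟ u) ≢ does (v ≟ u)
    sides-differ eq = contradiction (trans (sym side-u) (trans eq side-v)) λ ()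
    same-vertex : ∀ x → (Adj G x x → does (x ≟ u) ≢ does (x ≟ u)) × (does (x ≟ u) ≢ does (x ≟ u) → Adj G x x)
    same-vertex x = (λ x~x → ⊥-elim (adj⇒≢ x~x refl)) , (λ ≢-refl → contradiction refl ≢-refl)
    edges : ∀ x y → x ∈ pair u v → y ∈ pair u v →
            (Adj G x y → does (x ≟ u) ≢ does (y ≟ u)) × (does (x ≟ u) ≢ does (y ≟ u) → Adj G x y)
    edges x y x∈pair y∈pair with ∈-pair⁻ u v x x∈pair | ∈-pair⁻ u v y y∈pair
    ... | inj₁ refl | inj₁ refl = same-vertex x
    ... | inj₂ refl | inj₂ refl = same-vertex x
    ... | inj₁ refl | inj₂ refl = (λ _ → sides-differ) , (λ _ → u~v)
    ... | inj₂ refl | inj₁ refl = (λ _ → sides-differ ∘ sym) , (λ _ → trans (sym (adj-sym u v)) u~v)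

  complete⇒bipartition⊆pair : Complete → ∀ {W side u v} → IsBipartitionOf G W side →
                              u ∈ W → v ∈ W → u ≢ v → W ⊆ pair u v
  complete⇒bipartition⊆pair K {u = u} {v} bipartition u∈W v∈W u≢v w w∈W with w ≟ u | w ≟ v
  ... | yes _   | _       = refl
  ... | no _    | yes _   = refl
  ... | no w≢u  | no w≢v  = ⊥-elim (bipartition-triangle-free bipartition u∈W v∈W w∈W
                              (K u v u≢v) (K v w (w≢v ∘ sym)) (K u w (w≢u ∘ sym)))

  complete⇒pair-maximalBiclique : Complete → ∀ {u v} → u ≢ v → MaximalBiclique G (pair u v)
  complete⇒pair-maximalBiclique K {u} {v} u≢v =
    (_ , edge-bipartition (K u v u≢v)) ,
    λ { W (_ , bipartition) pair⊆W →
        complete⇒bipartition⊆pair K bipartition (pair⊆W u (∈-pairˡ u v)) (pair⊆W v (∈-pairʳ u v)) u≢v }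

  complete⇒pair-maximalStar : Complete → ∀ {u v} → u ≢ v → MaximalStar G (pair u v)
  complete⇒pair-maximalStar K {u} {v} u≢v =
    (_ , edge-bipartition (K u v u≢v) , u , centre) ,
    λ { W (_ , bipartition , _) pair⊆W →
        complete⇒bipartition⊆pair K bipartition (pair⊆W u (∈-pairˡ u v)) (pair⊆W v (∈-pairʳ u v)) u≢v }
    where
    centre : ∀ x → x ∈ pair u v → does (x ≟ u) ≡ true → x ≡ u
    centre x _ x-on-u-side with x ≟ u
    ... | yes x≡u = x≡u
    ... | no _    = contradiction x-on-u-side λ ()

  pair-monochromatic : ∀ {ρ : Coloring G} {u v} → ρ u ≡ ρ v → Monochromatic G ρ (pair u v)
  pair-monochromatic {ρ} {u} {v} ρu≡ρv = (u , ∈-pairˡ u v) , same-colour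
    where
    same-colour : ∀ x y → x ∈ pair u v → y ∈ pair u v → ρ x ≡ ρ y
    same-colour x y x∈pair y∈pair with ∈-pair⁻ u v x x∈pair | ∈-pair⁻ u v y y∈pair
    ... | inj₁ refl | inj₁ refl = refl
    ... | inj₂ refl | inj₂ refl = refl
    ... | inj₁ refl | inj₂ refl = ρu≡ρv
    ... | inj₂ refl | inj₁ refl = sym ρu≡ρv

  injective⇒bipartition-not-monochromatic : ∀ {ρ : Coloring G} {W side} → Injective _≡_ _≡_ ρ →
                                            IsBipartitionOf G W side → ¬ Monochromatic G ρ W
  injective⇒bipartition-not-monochromatic {side = side} ρ-injective
    ((a , a∈W , side-a) , (b , b∈W , side-b) , _) (_ , same-colour) =
    contradiction (trans (sym side-a) (trans (cong side (ρ-injective (same-colour a b a∈W b∈W))) side-b)) λ ()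

  injective⇒isBicliqueColoring : ∀ {ρ : Coloring G} → Injective _≡_ _≡_ ρ → IsBicliqueColoring G ρ
  injective⇒isBicliqueColoring ρ-injective _ ((_ , bipartition) , _) =
    injective⇒bipartition-not-monochromatic ρ-injective bipartition

  injective⇒isStarColoring : ∀ {ρ : Coloring G} → Injective _≡_ _≡_ ρ → IsStarColoring G ρ
  injective⇒isStarColoring ρ-injective _ ((_ , bipartition , _) , _) =
    injective⇒bipartition-not-monochromatic ρ-injective bipartition

  complete∧isBicliqueColoring⇒injective : Complete → ∀ {ρ : Coloring G} →
                                          IsBicliqueColoring G ρ → Injective _≡_ _≡_ ρ
  complete∧isBicliqueColoring⇒injective K coloring {u} {v} ρu≡ρv with u ≟ v
  ... | yes u≡v = u≡v
  ... | no u≢v  = contradiction (pair-monochromatic ρu≡ρv)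
                    (coloring _ (complete⇒pair-maximalBiclique K u≢v))

  complete∧isStarColoring⇒injective : Complete → ∀ {ρ : Coloring G} →
                                      IsStarColoring G ρ → Injective _≡_ _≡_ ρ
  complete∧isStarColoring⇒injective K coloring {u} {v} ρu≡ρv with u ≟ v
  ... | yes u≡v = u≡v
  ... | no u≢v  = contradiction (pair-monochromatic ρu≡ρv)
                    (coloring _ (complete⇒pair-maximalStar K u≢v))

module ProperMeansInjective {n : ℕ} (G : Graph n) (Proper : Coloring G → Set)
  (injective⇒proper : ∀ {ρ} → Injective _≡_ _≡_ ρ → Proper ρ)
  (proper⇒injective : ∀ {ρ} → Proper ρ → Injective _≡_ _≡_ ρ)
  where

  Colorable : ℕ → Set
  Colorable k = ∃[ ρ ] (IsKColoring G k ρ × Proper ρ)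

  Choosable : ℕ → Set
  Choosable k = ∀ L → IsKListAssignment G k L → ∃[ ρ ] (IsLColoring G L ρ × Proper ρ)

  choosable⇒colorable : ∀ {k} → Choosable k → Colorable k
  choosable⇒colorable {k} choosable with choosable (λ _ → palette k) (λ _ → palette-unique k , length-applyUpTo suc k)
  ... | ρ , ρ∈palette , proper = ρ , ∈-palette⁻ ∘ ρ∈palette , proper

  choosable-n : Choosable n
  choosable-n L L-size with distinct-representatives ℕ._≟_ n L (map₂ (≤-reflexive ∘ sym) ∘ L-size)
  ... | ρ , ρ∈L , ρ-injective = ρ , ρ∈L , injective⇒proper ρ-injective

  not-colorable : ∀ {k} → k < n → ¬ Colorable k
  not-colorable {k} k<n (ρ , ρ-bounded , proper) = <⇒≱ k<n (begin
    n                  ≤⟨ injective⇒≤length ρ ρ∈palette (proper⇒injective proper) ⟩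
    length (palette k) ≡⟨ length-applyUpTo suc k ⟩
    k                  ∎)
    where
    open ≤-Reasoning
    ρ∈palette : ∀ v → ρ v ∈ˡ palette k
    ρ∈palette v = ∈-palette⁺ (proj₁ (ρ-bounded v)) (proj₂ (ρ-bounded v))

  colorable-min : IsMin Colorable n
  colorable-min = choosable⇒colorable choosable-n , λ _ → not-colorable

  choosable-min : IsMin Choosable n
  choosable-min = choosable-n , λ _ k<n → not-colorable k<n ∘ choosable⇒colorable

theorem18 : (n : ℕ) (G : Graph n) → Connected G → P3Free G →
    chB G n × χB G n × χS G n × chS G n
theorem18 n G connected p3-free =
  Biclique.choosable-min , Biclique.colorable-min , Star.colorable-min , Star.choosable-min
  where
  K : Complete G
  K = connected∧P3Free⇒complete G connected p3-free
  module Biclique = ProperMeansInjective G (IsBicliqueColoring G)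
    (injective⇒isBicliqueColoring G) (complete∧isBicliqueColoring⇒injective G K)
  module Star = ProperMeansInjective G (IsStarColoring G)
    (injective⇒isStarColoring G) (complete∧isStarColoring⇒injective G K)
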